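{- Let $\sigma\in\mathfrak{S}_n$ and let $F=\{i:\sigma(i)>i\}$, $F'=\{i:i>\sigma^{ -1}(i)\}$, $G=\{i:\sigma(i)<i\}$, $G'=\{i:i<\sigma^{ -1}(i)\}$, $H=\{i:\sigma(i)=i\}$. The Laguerre digraph $L|_{H\cup G}$ consists of the following connected components: loops on the vertices $u\in H$; directed paths with at least two vertices, whose initial vertex is a cycle peak of $\sigma$ (i.e. lies in $F'\cap G$), whose final vertex is a cycle valley of $\sigma$ (i.e. lies in $F\cap G'$), and whose intermediate vertices (if any) are cycle double falls of $\sigma$ (i.e. lie in $G\cap G'$); and isolated vertices at the $u\in F\cap F'$ (the cycle double rises of $\sigma$). Furthermore, $L|_{H\cup G}$ contains no directed cycles other than loops.
   Context: $\mathfrak{S}_n$ is the set of permutations of $[n]$. For $S\subseteq[n]$, $L|_S$ denotes the directed graph with vertex set $[n]$ and edge set $\{u\to\sigma(u):u\in S\}$ (a Laguerre digraph: every vertex has in- and out-degree at most 1; its components are directed paths, including isolated vertices, and directed cycles, including loops $u\to u$). An index $i$ is a cycle peak if $\sigma^{ -1}(i)<i>\sigma(i)$, cycle valley if $\sigma^{ -1}(i)>i<\sigma(i)$, cycle double rise if $\sigma^{ -1}(i)<i<\sigma(i)$, cycle double fall if $\sigma^{ -1}(i)>i>\sigma(i)$. -}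

module Defs where

open import Data.Nat using (ℕ)
open import Data.Fin using (Fin; _<_)
open import Data.Fin.Permutation using (Permutation′; _⟨$⟩ʳ_; _⟨$⟩ˡ_)
open import Data.List using (List; _∷_; []; _∷ʳ_)
open import Data.List.Membership.Propositional using (_∈_)
open import Data.List.Relation.Unary.All using (All)
open import Data.List.Relation.Unary.Linked using (Linked)
open import Data.List.Relation.Unary.Unique.Propositional using (Unique)
open import Data.Product using (_×_; Σ)
open import Data.Sum using (_⊎_)
open import Relation.Binary.PropositionalEquality using (_≡_)
open import Relation.Nullary using (¬_)

-- [n] is modelled by Fin n (0-based, order-preserving relabelling).
module _ {n : ℕ} (σ : Permutation′ n) where

  F : Fin n → Set
  F i = i < σ ⟨$⟩ʳ i
  F' : Fin n → Set
  F' i = σ ⟨$⟩ˡ i < i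
  G : Fin n → Set
  G i = σ ⟨$⟩ʳ i < i
  G' : Fin n → Set
  G' i = i < σ ⟨$⟩ˡ i
  H : Fin n → Set
  H i = σ ⟨$⟩ʳ i ≡ i

-- Edge relation of the Laguerre digraph L|_S : edges u → σ(u) for u ∈ S.
Edge : {n : ℕ} → Permutation′ n → (Fin n → Set) → Fin n → Fin n → Set
Edge σ S u v = S u × σ ⟨$⟩ʳ u ≡ v

module _ {n : ℕ} (σ : Permutation′ n) (S : Fin n → Set) where

  Closed : List (Fin n) → Set
  Closed C = ∀ v w → Edge σ S v w → (v ∈ C ⊎ w ∈ C) → (v ∈ C × w ∈ C)

  LoopComponent : Fin n → Set
  LoopComponent u = Edge σ S u u × Closed (u ∷ [])

  Isolated : Fin n → Set
  Isolated u = (∀ v → ¬ Edge σ S u v) × (∀ v → ¬ Edge σ S v u)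

  -- a ∷ ms ∷ʳ b is the vertex sequence of a directed path with at least two
  -- vertices (initial vertex a, intermediate vertices ms, final vertex b)
  -- which forms a whole connected component of L|_S.
  PathComponent : Fin n → List (Fin n) → Fin n → Set
  PathComponent a ms b =
    Unique (a ∷ ms ∷ʳ b) × Linked (Edge σ S) (a ∷ ms ∷ʳ b) ×
    (∀ v → ¬ Edge σ S v a) × (∀ w → ¬ Edge σ S b w) ×
    Closed (a ∷ ms ∷ʳ b)

  LongCycle : Fin n → List (Fin n) → Fin n → Set
  LongCycle a ms b =
    Unique (a ∷ ms ∷ʳ b) × Linked (Edge σ S) (a ∷ ms ∷ʳ b) × Edge σ S b a

-- Every edge of L|_{H∪G} goes from u to σ(u) ≤ u, and every non-loop edge is a strict
-- descent.  Hence a vertex u that is not fixed lies on a unique maximal strictly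
-- descending run a → σ(a) → ⋯ → b of σ: walking forward from u along descents must stop
-- (at a b with σ(b) > b), and so must walking backward along σ⁻¹ while σ⁻¹ increases
-- (at an a with σ⁻¹(a) < a).  As an edge relation of a permutation is functional and
-- injective, such a run is a whole component; it degenerates to an isolated vertex when
-- a = b.  A long cycle is impossible since edges never increase.
module Submission where

open import Defs
open import Data.Nat using (ℕ)
import Data.Nat.Properties as ℕ
open import Data.Fin using (Fin; _<_; _>_; _≤_)
open import Data.Fin.Induction using (<-wellFounded; >-wellFounded)
open import Data.Fin.Permutation using (Permutation′; _⟨$⟩ʳ_; _⟨$⟩ˡ_; inverseˡ; inverseʳ)
open import Data.Fin.Properties using (<-irrefl; <-trans; _<?_; _≟_; ≤-reflexive; ≤-antisym; ≤∧≢⇒<)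
open import Data.List using (List; []; _∷_; _∷ʳ_)
open import Data.List.Membership.Propositional using (_∈_)
open import Data.List.Membership.Propositional.Properties using (∈-++⁺ʳ; ∈-++⁻)
open import Data.List.Relation.Unary.All as All using (All)
open import Data.List.Relation.Unary.AllPairs as AllPairs using ()
open import Data.List.Relation.Unary.Any using (here; there)
open import Data.List.Relation.Unary.Linked as Linked using (Linked; [-])
open import Data.List.Relation.Unary.Linked.Properties using (Linked⇒AllPairs)
open import Data.List.Relation.Unary.Unique.Propositional using (Unique)
open import Data.Product using (_×_; Σ; _,_; proj₂)
open import Data.Sum using (_⊎_; inj₁; inj₂)
open import Data.Empty using (⊥; ⊥-elim)
open import Induction.WellFounded using (Acc; acc)
open import Level using (Level)
open import Relation.Binary using (Rel; Transitive)
open import Relation.Binary.PropositionalEquality using (_≡_; refl; sym; trans; cong; subst)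
open import Relation.Nullary using (¬_; yes; no)

private
  variable
    c ℓ : Level
    A : Set c

module _ {R : Rel A ℓ} where

  -- The trivial segment is kept separate, so that a proper one has the shape
  -- x ∷ ms ∷ʳ y used by PathComponent.
  Segment : A → A → Set _
  Segment x y = x ≡ y ⊎ Σ (List A) λ ms → Linked R (x ∷ ms ∷ʳ y)

  vertices : ∀ {x y} → Segment x y → List A
  vertices {x = x} (inj₁ _) = x ∷ []
  vertices {x = x} {y} (inj₂ (ms , _)) = x ∷ ms ∷ʳ y

  source-∈ : ∀ {x y} (s : Segment x y) → x ∈ vertices s
  source-∈ (inj₁ _) = here refl
  source-∈ (inj₂ _) = here refl

  infixr 5 _◅_

  _◅_ : ∀ {w x y} → R w x → Segment x y → Segment w y
  r ◅ inj₁ refl = inj₂ ([] , r Linked.∷ [-])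
  r ◅ inj₂ (ms , lk) = inj₂ (_ ∷ ms , r Linked.∷ lk)

  ∈-◅ : ∀ {u w x y} (r : R w x) (s : Segment x y) → u ∈ vertices s → u ∈ vertices (r ◅ s)
  ∈-◅ r (inj₁ refl) u∈ = there u∈
  ∈-◅ r (inj₂ _) u∈ = there u∈

  Linked-path⁻ : ∀ {p q} {P : A → Set p} {Q : A → Set q} →
    (∀ {x y} → R x y → P x) → (∀ {x y} → R x y → Q y) →
    ∀ {x} ms {y} → Linked R (x ∷ ms ∷ʳ y) → P x × All (λ v → P v × Q v) ms × Q y
  Linked-path⁻ source target [] (r Linked.∷ [-]) = source r , All.[] , target r
  Linked-path⁻ source target (m ∷ ms) (r Linked.∷ lk) =
    let pm , inner , qy = Linked-path⁻ source target ms lk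
    in source r , (pm , target r) All.∷ inner , qy

  Linked⇒Unique : Transitive R → (∀ {x} → ¬ R x x) → ∀ {xs} → Linked R xs → Unique xs
  Linked⇒Unique trans irrefl lk =
    AllPairs.map (λ r x≡y → irrefl (subst (R _) (sym x≡y) r)) (Linked⇒AllPairs trans lk)

  module _ (functional : ∀ {v w w′} → R v w → R v w′ → w ≡ w′)
           (injective : ∀ {v v′ w} → R v w → R v′ w → v ≡ v′) where

    successor-∈ : ∀ xs {y v w} → Linked R (xs ∷ʳ y) → v ∈ xs → R v w → w ∈ xs ∷ʳ y
    successor-∈ (x ∷ []) (r Linked.∷ _) (here refl) e = there (here (functional e r))
    successor-∈ (x ∷ _ ∷ _) (r Linked.∷ _) (here refl) e = there (here (functional e r))
    successor-∈ (x ∷ xs@(_ ∷ _)) (_ Linked.∷ lk) (there v∈) e = there (successor-∈ xs lk v∈ e)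

    predecessor-∈ : ∀ {x} ys {v w} → Linked R (x ∷ ys) → w ∈ ys → R v w → v ∈ x ∷ ys
    predecessor-∈ (y ∷ ys) (r Linked.∷ _) (here refl) e = here (injective e r)
    predecessor-∈ (y ∷ ys) (_ Linked.∷ lk) (there w∈) e = there (predecessor-∈ ys lk w∈ e)

    path-closed : ∀ {x} ms {y} → Linked R (x ∷ ms ∷ʳ y) →
      (∀ v → ¬ R v x) → (∀ w → ¬ R y w) →
      let C = x ∷ ms ∷ʳ y in ∀ v w → R v w → v ∈ C ⊎ w ∈ C → v ∈ C × w ∈ C
    path-closed {x} ms {y} lk noIn noOut v w e (inj₁ v∈) with ∈-++⁻ (x ∷ ms) v∈
    ... | inj₁ v∈xms = v∈ , successor-∈ (x ∷ ms) lk v∈xms e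
    ... | inj₂ (here refl) = ⊥-elim (noOut w e)
    path-closed ms lk noIn noOut v w e (inj₂ (here refl)) = ⊥-elim (noIn v e)
    path-closed ms lk noIn noOut v w e (inj₂ (there w∈)) =
      predecessor-∈ (ms ∷ʳ _) lk w∈ e , there w∈

module _ {n : ℕ} (σ : Permutation′ n) where

  σ-injective : ∀ {x y} → σ ⟨$⟩ʳ x ≡ σ ⟨$⟩ʳ y → x ≡ y
  σ-injective eq = trans (sym (inverseˡ σ)) (trans (cong (σ ⟨$⟩ˡ_) eq) (inverseˡ σ))

  Edge-functional : ∀ {S v w w′} → Edge σ S v w → Edge σ S v w′ → w ≡ w′
  Edge-functional (_ , refl) (_ , refl) = refl

  Edge-injective : ∀ {S v v′ w} → Edge σ S v w → Edge σ S v′ w → v ≡ v′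
  Edge-injective (_ , eq) (_ , eq′) = σ-injective (trans eq (sym eq′))

  H∪G : Fin n → Set
  H∪G u = H σ u ⊎ G σ u

  Edge⇒≤ : ∀ {v w} → Edge σ H∪G v w → w ≤ v
  Edge⇒≤ (inj₁ fixed , refl) = ≤-reflexive fixed
  Edge⇒≤ (inj₂ descent , refl) = ℕ.<⇒≤ descent

  F⇒noOutEdge : ∀ {b} → F σ b → ∀ w → ¬ Edge σ H∪G b w
  F⇒noOutEdge b<σb w e@(_ , refl) = ℕ.<⇒≱ b<σb (Edge⇒≤ e)

  F'⇒noInEdge : ∀ {a} → F' σ a → ∀ v → ¬ Edge σ H∪G v a
  F'⇒noInEdge σ⁻¹a<a v e@(_ , refl) = ℕ.<⇒≱ (subst (_< _) (inverseˡ σ) σ⁻¹a<a) (Edge⇒≤ e)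

  Descent : Fin n → Fin n → Set
  Descent v w = σ ⟨$⟩ʳ v ≡ w × w < v

  Descent⇒Edge : ∀ {v w} → Descent v w → Edge σ H∪G v w
  Descent⇒Edge (refl , w<v) = inj₂ w<v , refl

  Descent⇒G : ∀ {v w} → Descent v w → G σ v
  Descent⇒G (refl , w<v) = w<v

  Descent⇒G' : ∀ {v w} → Descent v w → G' σ w
  Descent⇒G' (refl , w<v) = subst (_ <_) (sym (inverseˡ σ)) w<v

  H-of-σ⁻¹ : ∀ {x} → H σ (σ ⟨$⟩ˡ x) → H σ x
  H-of-σ⁻¹ {x} fixed = trans (cong (σ ⟨$⟩ʳ_) (trans (sym (inverseʳ σ {x})) fixed)) (inverseʳ σ)

  ¬H∧¬G⇒F : ∀ {x} → ¬ H σ x → ¬ G σ x → F σ x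
  ¬H∧¬G⇒F x∉H x∉G = ≤∧≢⇒< (ℕ.≮⇒≥ x∉G) (λ eq → x∉H (sym eq))

  ¬H∧¬G'⇒F' : ∀ {x} → ¬ H σ x → ¬ G' σ x → F' σ x
  ¬H∧¬G'⇒F' x∉H x∉G' = ≤∧≢⇒< (ℕ.≮⇒≥ x∉G') (λ eq → x∉H (H-of-σ⁻¹ (trans (inverseʳ σ) (sym eq))))

  DescentRun : Fin n → Fin n → Set
  DescentRun = Segment {R = Descent}

  descentRun : ∀ {x} → Acc _<_ x → ¬ H σ x → Σ (Fin n) λ b → F σ b × DescentRun x b
  descentRun {x} (acc rs) x∉H with σ ⟨$⟩ʳ x <? x
  ... | yes σx<x =
    let b , Fb , run = descentRun (rs σx<x) (λ fixed → x∉H (σ-injective fixed))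
    in b , Fb , (refl , σx<x) ◅ run
  ... | no σx≮x = x , ¬H∧¬G⇒F x∉H σx≮x , inj₁ refl

  extendBackward : ∀ {x b u} → Acc _>_ x → ¬ H σ x → (run : DescentRun x b) → u ∈ vertices run →
    Σ (Fin n) λ a → F' σ a × Σ (DescentRun a b) λ run′ → u ∈ vertices run′
  extendBackward {x} (acc rs) x∉H run u∈ with x <? σ ⟨$⟩ˡ x
  ... | yes x<σ⁻¹x =
    extendBackward (rs x<σ⁻¹x) (λ fixed → x∉H (H-of-σ⁻¹ fixed)) (step ◅ run) (∈-◅ step run u∈)
    where step = inverseʳ σ , x<σ⁻¹x
  ... | no x≮σ⁻¹x = x , ¬H∧¬G'⇒F' x∉H x≮σ⁻¹x , run , u∈

  loopComponent : ∀ {u} → H σ u → LoopComponent σ H∪G u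
  loopComponent {u} fixed = loop , closed
    where
    loop : Edge σ H∪G u u
    loop = inj₁ fixed , fixed
    closed : Closed σ H∪G (u ∷ [])
    closed v w (_ , refl) (inj₁ (here refl)) = here refl , here fixed
    closed v w e (inj₂ (here refl)) = here (Edge-injective e loop) , here refl

  isolated : ∀ {u} → F σ u → F' σ u → Isolated σ H∪G u
  isolated Fu F'u = F⇒noOutEdge Fu , F'⇒noInEdge F'u

  descentPath-component : ∀ {a} ms {b} → Linked Descent (a ∷ ms ∷ʳ b) →
    F' σ a → F σ b → PathComponent σ H∪G a ms b
  descentPath-component ms run F'a Fb =
    Linked⇒Unique (λ p q → <-trans q p) (<-irrefl refl) (Linked.map proj₂ run) ,
    edges , F'⇒noInEdge F'a , F⇒noOutEdge Fb ,
    path-closed (Edge-functional {H∪G}) (Edge-injective {H∪G}) ms edges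
      (F'⇒noInEdge F'a) (F⇒noOutEdge Fb)
    where
    edges : Linked (Edge σ H∪G) _
    edges = Linked.map Descent⇒Edge run

  noLongCycle : ∀ a ms b → LongCycle σ H∪G a ms b → ⊥
  noLongCycle a ms b (a∉ AllPairs.∷ _ , path , b→a)
    with Linked⇒AllPairs (λ p q → ℕ.≤-trans q p) (Linked.map Edge⇒≤ path)
  ... | a≥ AllPairs.∷ _ = All.lookup a∉ b∈ (≤-antisym (Edge⇒≤ b→a) (All.lookup a≥ b∈))
    where b∈ = ∈-++⁺ʳ ms (here refl)

  PeakToValleyPath : Fin n → Set
  PeakToValleyPath u = Σ (Fin n) λ a → Σ (List (Fin n)) λ ms → Σ (Fin n) λ b →
    PathComponent σ H∪G a ms b × u ∈ (a ∷ ms ∷ʳ b) ×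
    (F' σ a × G σ a) × (F σ b × G' σ b) × All (λ v → G σ v × G' σ v) ms

  classify : ∀ u →
    (H σ u × LoopComponent σ H∪G u) ⊎ PeakToValleyPath u ⊎ (F σ u × F' σ u × Isolated σ H∪G u)
  classify u with σ ⟨$⟩ʳ u ≟ u
  ... | yes fixed = inj₁ (fixed , loopComponent fixed)
  ... | no u∉H with descentRun (<-wellFounded u) u∉H
  ... | b , Fb , forward with extendBackward (>-wellFounded u) u∉H forward (source-∈ forward)
  ... | a , F'a , inj₁ refl , here refl = inj₂ (inj₂ (Fb , F'a , isolated Fb F'a))
  ... | a , F'a , inj₂ (ms , run) , u∈ =
    let Ga , inner , G'b = Linked-path⁻ Descent⇒G Descent⇒G' ms run
    in inj₂ (inj₁ (a , ms , b , descentPath-component ms run F'a Fb , u∈ ,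
                   (F'a , Ga) , (Fb , G'b) , inner))

lemma6p3 : (n : ℕ) (σ : Permutation′ n) →
  let S = λ (u : Fin n) → H σ u ⊎ G σ u in
  ((u : Fin n) →
      (H σ u × LoopComponent σ S u)
    ⊎ (Σ (Fin n) λ a → Σ (List (Fin n)) λ ms → Σ (Fin n) λ b →
         PathComponent σ S a ms b × u ∈ (a ∷ ms ∷ʳ b) ×
         (F' σ a × G σ a) × (F σ b × G' σ b) ×
         All (λ v → G σ v × G' σ v) ms)
    ⊎ (F σ u × F' σ u × Isolated σ S u))
  × ((a : Fin n) (ms : List (Fin n)) (b : Fin n) → LongCycle σ S a ms b → ⊥)
lemma6p3 n σ = classify σ , noLongCycle σ
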